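{- The corner-removal game on any chess-colored truncated square diagram is balanced.
   Context: Consider diagrams of cells, subsets of an $n\times n$ array of square cells, with each cell colored black or white. Two cells are neighbors if they share a side. A cell of a diagram is a corner if, among the cells present, it has at most one neighboring cell in its row and at most one neighboring cell in its column. A truncated square diagram is any diagram obtained from a full $n\times n$ array by iteratively removing corners. A chess coloring is one in which neighbors have different colors. The corner-removal game: White and Black alternately remove a corner of the current diagram of their own color; a player who cannot move loses. A position (the current diagram with its coloring) is balanced if (i) every position reachable from it in one move (by either player) is balanced, and (ii) whenever all its removable elements (its corners) are of the same color, at least half of its cells have that color. -}

module Defs where

open import Data.Nat using (ℕ; zero; suc; _+_; _*_; _≤_)
open import Data.Fin using (Fin; toℕ; _≟_)
open import Data.Product using (_×_; _,_)
open import Data.Sum using (_⊎_)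
open import Data.Bool using (Bool; true; false; if_then_else_; _∧_)
open import Data.List using (List; allFin; map)
open import Data.Nat.ListAction using (sum)
open import Relation.Nullary using (¬_; yes; no)
open import Relation.Nullary.Decidable using (⌊_⌋)
open import Relation.Binary.PropositionalEquality using (_≡_; _≢_)

-- A cell of the n × n array: (row , column).
Cell : ℕ → Set
Cell n = Fin n × Fin n

Diagram : ℕ → Set
Diagram n = Cell n → Bool

data Color : Set where
  white black : Color

Coloring : ℕ → Set
Coloring n = Cell n → Color

full : (n : ℕ) → Diagram n
full n _ = true

AdjIdx : {n : ℕ} → Fin n → Fin n → Set
AdjIdx a b = (toℕ b ≡ suc (toℕ a)) ⊎ (toℕ a ≡ suc (toℕ b))

Neighbors : {n : ℕ} → Cell n → Cell n → Set
Neighbors (i , j) (i' , j') = ((i ≡ i') × AdjIdx j j') ⊎ ((j ≡ j') × AdjIdx i i')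

Present : {n : ℕ} → Diagram n → Cell n → Set
Present D c = D c ≡ true

Corner : {n : ℕ} → Diagram n → Cell n → Set
Corner {n} D (i , j) =
  Present D (i , j)
  × (∀ (j₁ j₂ : Fin n) → Present D (i , j₁) → AdjIdx j j₁
       → Present D (i , j₂) → AdjIdx j j₂ → j₁ ≡ j₂)
  × (∀ (i₁ i₂ : Fin n) → Present D (i₁ , j) → AdjIdx i i₁
       → Present D (i₂ , j) → AdjIdx i i₂ → i₁ ≡ i₂)

remove : {n : ℕ} → Diagram n → Cell n → Diagram n
remove D (i , j) (i' , j') =
  if ⌊ i ≟ i' ⌋ ∧ ⌊ j ≟ j' ⌋ then false else D (i' , j')

data TruncatedSquare (n : ℕ) : Diagram n → Set where
  fullTS   : TruncatedSquare n (full n)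
  removeTS : ∀ {D} c → TruncatedSquare n D → Corner D c
             → TruncatedSquare n (remove D c)

ChessColoring : {n : ℕ} → Diagram n → Coloring n → Set
ChessColoring D col =
  ∀ c c' → Present D c → Present D c' → Neighbors c c' → col c ≢ col c'

countCells : (n : ℕ) → (Cell n → Bool) → ℕ
countCells n p =
  sum (map (λ i → sum (map (λ j → if p (i , j) then 1 else 0) (allFin n))) (allFin n))

_≟C_ : Color → Color → Bool
white ≟C white = true
black ≟C black = true
_     ≟C _     = false

size : {n : ℕ} → Diagram n → ℕ
size {n} D = countCells n D

sizeOf : {n : ℕ} → Diagram n → Coloring n → Color → ℕ
sizeOf {n} D col k = countCells n (λ c → D c ∧ (col c ≟C k))

-- Balanced positions of the corner-removal game (with a fixed coloring).
-- A move (by either player) removes a corner; the inductive definition is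
-- well-founded since each move removes a cell.
data Balanced {n : ℕ} (col : Coloring n) : Diagram n → Set where
  balanced : ∀ {D}
    → (∀ c → Corner D c → Balanced col (remove D c))
    → (∀ k → (∀ c → Corner D c → col c ≡ k) → size D ≤ 2 * sizeOf D col k)
    → Balanced col D

-- A truncated square diagram is column-convex (a corner has at most one
-- vertical neighbour, so deleting it cannot split a column), and a chess
-- colouring makes neighbours of opposite colour.  Suppose every corner has
-- colour k and let O be the cells of the other colour.  Charge each cell of O
-- once through its right side and once through its left side.  Through the
-- right side: if it has a right neighbour, send it there (a k-cell with a left
-- neighbour); otherwise it is not a corner, so it has cells above and below,
-- and we send it to the one facing away from the cells of the column to its
-- right (a k-cell without right neighbour, by column convexity).  These maps
-- and their mirror images are injective, so 2|O| ≤ 2|K|.  Removing a corner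
-- keeps a chess-coloured truncated square, so balance follows by induction on
-- the number of cells.
module Submission where

open import Defs
open import Data.Bool using (Bool; true; false; T; not; _∧_; if_then_else_)
open import Data.Bool.Properties using (T-∧; T-≡)
open import Data.Empty using (⊥-elim)
open import Data.Fin using (Fin; toℕ; fromℕ<; _≟_)
open import Data.Fin.Properties using (toℕ<n; toℕ-fromℕ<; fromℕ<-toℕ; toℕ-injective)
open import Data.List using (List; []; _∷_; _++_; length; map; filterᵇ; allFin; cartesianProduct)
open import Data.List.Membership.Propositional using (_∈_)
open import Data.List.Membership.Propositional.Properties
  using (∈-filter⁺; ∈-filter⁻; ∈-map⁺; ∈-cartesianProduct⁺; ∈-allFin)
open import Data.List.Properties using (length-removeAt′; length-++; filter-++)
open import Data.List.Relation.Unary.All using (lookup)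
open import Data.List.Relation.Unary.Any using (here; there; index; _─_)
open import Data.List.Relation.Unary.Unique.Propositional using (Unique; _∷_)
open import Data.List.Relation.Unary.Unique.Propositional.Properties
  using (filter⁺; map⁺; cartesianProduct⁺; allFin⁺)
open import Data.Nat using (ℕ; zero; suc; pred; _+_; _*_; _≤_; _<_; z≤n; s≤s; _<?_)
  renaming (_≟_ to _≟ℕ_)
open import Data.Nat.Induction using (<-wellFounded)
open import Data.Nat.ListAction using (sum)
open import Data.Nat.Properties
  using ( ≤-refl; ≤-trans; ≤-pred; ≤-<-trans; ≤∧≢⇒<; n≤1+n; m≤n⇒m≤1+n; m<n⇒m<1+n; n<1+n
        ; +-suc; +-identityʳ; +-mono-≤; +-monoʳ-≤; +-mono-<; ≮⇒≥; <⇒≱; <⇒≢; suc-injective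
        ; module ≤-Reasoning)
open import Data.Nat.Tactic.RingSolver using (solve-∀)
open import Data.Product using (_×_; _,_; proj₁; proj₂; ∃)
open import Data.Product.Properties using (≡-dec)
open import Data.Sum using (_⊎_; inj₁; inj₂; [_,_])
open import Function using (_∘_; _on_; _⇔_; mk⇔; Equivalence)
open import Induction.WellFounded using (Acc; acc)
open import Relation.Binary.PropositionalEquality
  using (_≡_; _≢_; refl; sym; trans; cong; cong₂; subst; subst₂; module ≡-Reasoning)
import Relation.Binary.Construct.On as On
open import Relation.Nullary using (¬_; yes; no; contradiction)
open import Relation.Nullary.Decidable using (⌊_⌋; T?; _×-dec_; decidable-stable)

open Equivalence using (to; from)

module _ {A : Set} where

  count : (A → Bool) → List A → ℕ
  count p xs = length (filterᵇ p xs)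

  count-mono : ∀ {p q : A → Bool} → (∀ {x} → T (p x) → T (q x)) → ∀ xs → count p xs ≤ count q xs
  count-mono p⇒q [] = z≤n
  count-mono {p} {q} p⇒q (x ∷ xs) with p x in px | q x in qx
  ... | true  | true  = s≤s (count-mono p⇒q xs)
  ... | true  | false = ⊥-elim (subst T qx (p⇒q (subst T (sym px) _)))
  ... | false | true  = m≤n⇒m≤1+n (count-mono p⇒q xs)
  ... | false | false = count-mono p⇒q xs

  count-split : ∀ (p q : A → Bool) xs →
    count p xs ≡ count (λ x → p x ∧ q x) xs + count (λ x → p x ∧ not (q x)) xs
  count-split p q [] = refl
  count-split p q (x ∷ xs) with p x | q x
  ... | true  | true  = cong suc (count-split p q xs)
  ... | true  | false = trans (cong suc (count-split p q xs)) (sym (+-suc _ _))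
  ... | false | _     = count-split p q xs

  count-mono-< : ∀ {p q : A → Bool} {x xs} → x ∈ xs → T (p x) → ¬ T (q x) →
    (∀ {y} → T (q y) → T (p y)) → count q xs < count p xs
  count-mono-< {p} {q} {x} (here {xs = xs} refl) px ¬qx q⇒p with p x | q x
  ... | true  | false = s≤s (count-mono {q} {p} q⇒p xs)
  ... | true  | true  = ⊥-elim (¬qx _)
  count-mono-< {p} {q} {x} (there {y} x∈xs) px ¬qx q⇒p with p y in py | q y in qy
  ... | true  | true  = s≤s (count-mono-< x∈xs px ¬qx q⇒p)
  ... | true  | false = m≤n⇒m≤1+n (count-mono-< x∈xs px ¬qx q⇒p)
  ... | false | false = count-mono-< x∈xs px ¬qx q⇒p
  ... | false | true  = ⊥-elim (subst T py (q⇒p (subst T (sym qy) _)))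

  count-cong : ∀ {p q : A → Bool} → (∀ x → p x ≡ q x) → ∀ xs → count p xs ≡ count q xs
  count-cong p≗q [] = refl
  count-cong {p} {q} p≗q (x ∷ xs) with p x | q x | p≗q x
  ... | true  | .true  | refl = cong suc (count-cong p≗q xs)
  ... | false | .false | refl = count-cong p≗q xs

  count-++ : ∀ (p : A → Bool) xs ys → count p (xs ++ ys) ≡ count p xs + count p ys
  count-++ p xs ys = trans (cong length (filter-++ (T? ∘ p) xs ys)) (length-++ (filterᵇ p xs))

  sum-indicator : ∀ (p : A → Bool) xs → sum (map (λ x → if p x then 1 else 0) xs) ≡ count p xs
  sum-indicator p [] = refl
  sum-indicator p (x ∷ xs) with p x
  ... | true  = cong suc (sum-indicator p xs)
  ... | false = sum-indicator p xs

module _ {A B : Set} where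

  count-map : ∀ (p : B → Bool) (f : A → B) xs → count p (map f xs) ≡ count (p ∘ f) xs
  count-map p f [] = refl
  count-map p f (x ∷ xs) with p (f x)
  ... | true  = cong suc (count-map p f xs)
  ... | false = count-map p f xs

  ∈-─ : ∀ {y z : B} {ys} (y∈ys : y ∈ ys) → z ∈ ys → z ≢ y → z ∈ (ys ─ y∈ys)
  ∈-─ (here refl) (here refl)    z≢y = ⊥-elim (z≢y refl)
  ∈-─ (here refl) (there z∈ys)   _   = z∈ys
  ∈-─ (there _)   (here refl)    _   = here refl
  ∈-─ (there y∈ys) (there z∈ys) z≢y = there (∈-─ y∈ys z∈ys z≢y)

  length-≤-injective : ∀ (f : A → B) {xs ys} → Unique xs →
    (∀ {x y} → x ∈ xs → y ∈ xs → f x ≡ f y → x ≡ y) →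
    (∀ {x} → x ∈ xs → f x ∈ ys) → length xs ≤ length ys
  length-≤-injective f {[]} _ _ _ = z≤n
  length-≤-injective f {x ∷ xs} {ys} (x∉xs ∷ xs-unique) inj f∈ys =
    subst (suc (length xs) ≤_) (sym (length-removeAt′ ys (index fx∈ys)))
      (s≤s (length-≤-injective f xs-unique (λ u v → inj (there u) (there v)) fy∈rest))
    where
      fx∈ys : f x ∈ ys
      fx∈ys = f∈ys (here refl)

      fy∈rest : ∀ {y} → y ∈ xs → f y ∈ (ys ─ fx∈ys)
      fy∈rest y∈xs = ∈-─ fx∈ys (f∈ys (there y∈xs))
        (λ fy≡fx → lookup x∉xs y∈xs (sym (inj (there y∈xs) (here refl) fy≡fx)))

  count-≤-injective : ∀ {p : A → Bool} {q : B → Bool} (f : A → B) {xs ys} → Unique xs →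
    (∀ {x y} → T (p x) → T (p y) → f x ≡ f y → x ≡ y) →
    (∀ {x} → x ∈ xs → T (p x) → f x ∈ ys × T (q (f x))) → count p xs ≤ count q ys
  count-≤-injective {p} {q} f {xs} xs-unique inj maps =
    length-≤-injective f (filter⁺ (T? ∘ p) xs-unique)
      (λ x∈ y∈ → inj (proj₂ (filtered x∈)) (proj₂ (filtered y∈)))
      (λ x∈ → let fx∈ys , qfx = maps (proj₁ (filtered x∈)) (proj₂ (filtered x∈))
              in ∈-filter⁺ (T? ∘ q) fx∈ys qfx)
    where
      filtered : ∀ {x} → x ∈ filterᵇ p xs → x ∈ xs × T (p x)
      filtered = ∈-filter⁻ (T? ∘ p)

module _ {A B : Set} where

  sum-indicator-cartesianProduct : ∀ (p : A × B → Bool) xs ys →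
    sum (map (λ x → sum (map (λ y → if p (x , y) then 1 else 0) ys)) xs) ≡
    count p (cartesianProduct xs ys)
  sum-indicator-cartesianProduct p [] ys = refl
  sum-indicator-cartesianProduct p (x ∷ xs) ys = begin
    sum (map (λ y → if p (x , y) then 1 else 0) ys) + _
      ≡⟨ cong₂ _+_ (sum-indicator (p ∘ (x ,_)) ys) (sum-indicator-cartesianProduct p xs ys) ⟩
    count (p ∘ (x ,_)) ys + count p (cartesianProduct xs ys)
      ≡⟨ cong (_+ _) (sym (count-map p (x ,_) ys)) ⟩
    count p (map (x ,_) ys) + count p (cartesianProduct xs ys)
      ≡⟨ sym (count-++ p (map (x ,_) ys) _) ⟩
    count p (cartesianProduct (x ∷ xs) ys) ∎
    where open ≡-Reasoning

T-not⇒¬T : ∀ {b} → T (not b) → ¬ T b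
T-not⇒¬T {true} ()

¬T⇒T-not : ∀ {b} → ¬ T b → T (not b)
¬T⇒T-not {true}  ¬b = ¬b _
¬T⇒T-not {false} _  = _

-- The counting argument runs on ℕ × ℕ, where neighbours are given by suc and
-- the boundary of the array needs no bookkeeping; see `extend` below.
Point : Set
Point = ℕ × ℕ

AdjacentIndex : ℕ → ℕ → Set
AdjacentIndex a b = (b ≡ suc a) ⊎ (a ≡ suc b)

Adjacent : Point → Point → Set
Adjacent (i , j) (i′ , j′) = (i ≡ i′ × AdjacentIndex j j′) ⊎ (j ≡ j′ × AdjacentIndex i i′)

before : (ℕ → Bool) → ℕ → Bool
before line zero    = false
before line (suc m) = line m

before-view : ∀ {line k} → T (before line k) → ∃ λ m → k ≡ suc m × T (line m)
before-view {k = suc m} l = m , refl , l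

module Board (board : Point → Bool) where

  hasLeft hasRight hasAbove hasBelow : Point → Bool
  hasLeft  (i , j) = before (λ m → board (i , m)) j
  hasRight (i , j) = board (i , suc j)
  hasAbove (i , j) = before (λ m → board (m , j)) i
  hasBelow (i , j) = board (suc i , j)

  ColumnConvex : Set
  ColumnConvex = ∀ j {a b d} → a ≤ b → b ≤ d →
    T (board (a , j)) → T (board (d , j)) → T (board (b , j))

module _ {board : Point → Bool} where

  open Board board

  columnConvex-delete : ColumnConvex → ∀ {x} → ¬ (T (hasAbove x) × T (hasBelow x)) →
    (board′ : Point → Bool) → (∀ {y} → T (board′ y) → T (board y)) →
    (∀ {y} → T (board y) → y ≢ x → T (board′ y)) → ¬ T (board′ x) → Board.ColumnConvex board′
  columnConvex-delete convex {x} lonely board′ ⊆ keep gone j {a} {b} {d} a≤b b≤d a∈ d∈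
    with ≡-dec _≟ℕ_ _≟ℕ_ (b , j) x
  ... | no b≢x = keep (convex j a≤b b≤d (⊆ a∈) (⊆ d∈)) b≢x
  ... | yes refl = ⊥-elim (lonely (above a≤b b≤d a≢b , below))
    where
      a≢b : a ≢ b
      a≢b refl = gone a∈

      b≢d : b ≢ d
      b≢d refl = gone d∈

      above : ∀ {b} → a ≤ b → b ≤ d → a ≢ b → T (hasAbove (b , j))
      above {zero}  z≤n _   a≢0 = ⊥-elim (a≢0 refl)
      above {suc b} a≤b b≤d a≢b =
        convex j (≤-pred (≤∧≢⇒< a≤b a≢b)) (≤-trans (n≤1+n b) b≤d) (⊆ a∈) (⊆ d∈)

      below : T (hasBelow (b , j))
      below = convex j (m≤n⇒m≤1+n a≤b) (≤∧≢⇒< b≤d b≢d) (⊆ a∈) (⊆ d∈)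

module Balance (board marked : Point → Bool) where

  open Board board

  markedCell unmarkedCell : Point → Bool
  markedCell   x = board x ∧ marked x
  unmarkedCell x = board x ∧ not (marked x)

  module _
    (U : List Point) (U-unique : Unique U) (U-complete : ∀ {x} → T (board x) → x ∈ U)
    (convex : ColumnConvex)
    (opposite : ∀ {x y} → T (unmarkedCell x) → T (board y) → Adjacent x y → T (marked y))
    (notCorner : ∀ {x} → T (unmarkedCell x) → ¬ T (hasLeft x) ⊎ ¬ T (hasRight x) →
                 T (hasAbove x) × T (hasBelow x))
    where

    onBoard : ∀ {x} → T (unmarkedCell x) → T (board x)
    onBoard u = proj₁ (to T-∧ u)

    markedNeighbour : ∀ {x y} → T (unmarkedCell x) → T (board y) → Adjacent x y →
                      y ∈ U × T (markedCell y)
    markedNeighbour u by adj = U-complete by , from T-∧ (by , opposite u by adj)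

    unmarkedRight≤markedLeft :
      count (λ x → unmarkedCell x ∧ hasRight x) U ≤ count (λ x → markedCell x ∧ hasLeft x) U
    unmarkedRight≤markedLeft = count-≤-injective toRight U-unique (λ _ _ → injective) lands
      where
        toRight : Point → Point
        toRight (i , j) = i , suc j

        injective : ∀ {x y} → toRight x ≡ toRight y → x ≡ y
        injective {_ , _} {_ , _} refl = refl

        lands : ∀ {x} → x ∈ U → T (unmarkedCell x ∧ hasRight x) →
                toRight x ∈ U × T (markedCell (toRight x) ∧ hasLeft (toRight x))
        lands {i , j} _ p =
          let u , r = to T-∧ p
              y∈U , m = markedNeighbour u r (inj₁ (refl , inj₁ refl))
          in y∈U , from T-∧ (m , onBoard u)

    unmarkedLeft≤markedRight :
      count (λ x → unmarkedCell x ∧ hasLeft x) U ≤ count (λ x → markedCell x ∧ hasRight x) U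
    unmarkedLeft≤markedRight = count-≤-injective toLeft U-unique injective lands
      where
        toLeft : Point → Point
        toLeft (i , j) = i , pred j

        injective : ∀ {x y} → T (unmarkedCell x ∧ hasLeft x) → T (unmarkedCell y ∧ hasLeft y) →
                    toLeft x ≡ toLeft y → x ≡ y
        injective {_ , suc _} {_ , suc _} _ _ refl = refl
        injective {_ , zero} p _ _ = ⊥-elim (proj₂ (to T-∧ p))
        injective {_ , suc _} {_ , zero} _ p _ = ⊥-elim (proj₂ (to T-∧ p))

        lands : ∀ {x} → x ∈ U → T (unmarkedCell x ∧ hasLeft x) →
                toLeft x ∈ U × T (markedCell (toLeft x) ∧ hasRight (toLeft x))
        lands {i , zero} _ p = ⊥-elim (proj₂ (to T-∧ p))
        lands {i , suc j} _ p =
          let u , l = to T-∧ p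
              y∈U , m = markedNeighbour u l (inj₁ (refl , inj₂ refl))
          in y∈U , from T-∧ (m , onBoard u)

    module _ (side : Point → Bool) (side-convex : Board.ColumnConvex side)
             (sideless⇒vertical : ∀ {x} → T (unmarkedCell x) → ¬ T (side x) →
                                  T (hasAbove x) × T (hasBelow x))
      where

      sideFreeUpTo : ℕ → ℕ → Bool
      sideFreeUpTo zero    j = not (side (zero , j))
      sideFreeUpTo (suc i) j = not (side (suc i , j)) ∧ sideFreeUpTo i j

      sideFree⇒¬side : ∀ {i j} → T (sideFreeUpTo i j) → ¬ T (side (i , j))
      sideFree⇒¬side {zero}  free = T-not⇒¬T free
      sideFree⇒¬side {suc i} free = T-not⇒¬T (proj₁ (to T-∧ free))

      sideFree-pred : ∀ {i j} → T (sideFreeUpTo (suc i) j) → T (sideFreeUpTo i j)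
      sideFree-pred free = proj₂ (to T-∧ free)

      ¬sideFree⇒side : ∀ {i j} → ¬ T (sideFreeUpTo i j) → ∃ λ r → r ≤ i × T (side (r , j))
      ¬sideFree⇒side {i} {j} ¬free with T? (side (i , j))
      ... | yes s = i , ≤-refl , s
      ¬sideFree⇒side {zero}  ¬free | no ¬s = ⊥-elim (¬free (¬T⇒T-not ¬s))
      ¬sideFree⇒side {suc i} ¬free | no ¬s =
        let r , r≤i , s = ¬sideFree⇒side (λ free → ¬free (from T-∧ (¬T⇒T-not ¬s , free)))
        in r , m≤n⇒m≤1+n r≤i , s

      -- Move a cell up if nothing above it in its column has `side`, and down
      -- otherwise (convexity of `side` then leaves the cell below without it).
      -- Up- and down-moves cannot collide because `sideFreeUpTo` is antitone
      -- in the row.  Row 0 is junk: the cells moved all have a cell above.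
      shift : Point → Point
      shift (zero , j) = zero , j
      shift (suc i , j) with sideFreeUpTo i j
      ... | true  = i , j
      ... | false = suc (suc i) , j

      shift-lands : ∀ {x} → T (unmarkedCell x) → ¬ T (side x) →
                    T (board (shift x)) × Adjacent x (shift x) × ¬ T (side (shift x))
      shift-lands {zero , j} u ¬s = ⊥-elim (proj₁ (sideless⇒vertical u ¬s))
      shift-lands {suc i , j} u ¬s with sideFreeUpTo i j in free | sideless⇒vertical u ¬s
      ... | true  | above , _ = above , inj₂ (refl , inj₂ refl) , sideFree⇒¬side (from T-≡ free)
      ... | false | _ , below = below , inj₂ (refl , inj₁ refl) , λ s↓ →
            let r , r≤i , s = ¬sideFree⇒side (subst T free)
            in ¬s (side-convex j (m≤n⇒m≤1+n r≤i) (n≤1+n (suc i)) s s↓)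

      shift-injective : ∀ {x y} → T (hasAbove x) → T (hasAbove y) → shift x ≡ shift y → x ≡ y
      shift-injective {suc a , j} {suc b , j′} _ _ eq
        with sideFreeUpTo a j in freeA | sideFreeUpTo b j′ in freeB | eq
      ... | true  | true  | refl = refl
      ... | false | false | refl = refl
      ... | true  | false | refl =
            ⊥-elim (subst T freeB (sideFree-pred (sideFree-pred (from T-≡ freeA))))
      ... | false | true  | refl =
            ⊥-elim (subst T freeA (sideFree-pred (sideFree-pred (from T-≡ freeB))))

      unmarkedSideless≤markedSideless :
        count (λ x → unmarkedCell x ∧ not (side x)) U ≤ count (λ x → markedCell x ∧ not (side x)) U
      unmarkedSideless≤markedSideless =
        count-≤-injective shift U-unique (λ p q → shift-injective (above p) (above q)) lands
        where
          above : ∀ {x} → T (unmarkedCell x ∧ not (side x)) → T (hasAbove x)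
          above p = let u , ns = to T-∧ p in proj₁ (sideless⇒vertical u (T-not⇒¬T ns))

          lands : ∀ {x} → x ∈ U → T (unmarkedCell x ∧ not (side x)) →
                  shift x ∈ U × T (markedCell (shift x) ∧ not (side (shift x)))
          lands _ p =
            let u , ns = to T-∧ p
                b , adj , ns′ = shift-lands u (T-not⇒¬T ns)
                y∈U , m = markedNeighbour u b adj
            in y∈U , from T-∧ (m , ¬T⇒T-not ns′)

    unmarked≤marked : count unmarkedCell U ≤ count markedCell U
    unmarked≤marked = m+m≤n+n⇒m≤n (begin
      #O + #O
        ≡⟨ cong₂ _+_ (count-split unmarkedCell hasRight U) (count-split unmarkedCell hasLeft U) ⟩
      (#O∧ hasRight + #O∧¬ hasRight) + (#O∧ hasLeft + #O∧¬ hasLeft)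
        ≤⟨ +-mono-≤ (+-mono-≤ unmarkedRight≤markedLeft withoutRight)
                    (+-mono-≤ unmarkedLeft≤markedRight withoutLeft) ⟩
      (#K∧ hasLeft + #K∧¬ hasRight) + (#K∧ hasRight + #K∧¬ hasLeft)
        ≡⟨ exchange (#K∧ hasLeft) (#K∧¬ hasRight) (#K∧ hasRight) (#K∧¬ hasLeft) ⟩
      (#K∧ hasLeft + #K∧¬ hasLeft) + (#K∧ hasRight + #K∧¬ hasRight)
        ≡⟨ sym (cong₂ _+_ (count-split markedCell hasLeft U) (count-split markedCell hasRight U)) ⟩
      #K + #K ∎)
      where
        open ≤-Reasoning

        #O #K : ℕ
        #O = count unmarkedCell U
        #K = count markedCell U

        #O∧_ #O∧¬_ #K∧_ #K∧¬_ : (Point → Bool) → ℕ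
        #O∧  q = count (λ x → unmarkedCell x ∧ q x) U
        #O∧¬ q = count (λ x → unmarkedCell x ∧ not (q x)) U
        #K∧  q = count (λ x → markedCell x ∧ q x) U
        #K∧¬ q = count (λ x → markedCell x ∧ not (q x)) U

        m+m≤n+n⇒m≤n : ∀ {m n} → m + m ≤ n + n → m ≤ n
        m+m≤n+n⇒m≤n h = ≮⇒≥ λ n<m → <⇒≱ (+-mono-< n<m n<m) h

        exchange : ∀ a b c d → (a + b) + (c + d) ≡ (a + d) + (c + b)
        exchange = solve-∀

        rightConvex : Board.ColumnConvex hasRight
        rightConvex j = convex (suc j)

        leftConvex : Board.ColumnConvex hasLeft
        leftConvex zero    _ _ ()
        leftConvex (suc j) = convex j

        withoutRight : #O∧¬ hasRight ≤ #K∧¬ hasRight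
        withoutRight =
          unmarkedSideless≤markedSideless hasRight rightConvex (λ u → notCorner u ∘ inj₂)

        withoutLeft : #O∧¬ hasLeft ≤ #K∧¬ hasLeft
        withoutLeft =
          unmarkedSideless≤markedSideless hasLeft leftConvex (λ u → notCorner u ∘ inj₁)

    board≤2*marked : count board U ≤ 2 * count markedCell U
    board≤2*marked = begin
      count board U     ≡⟨ count-split board marked U ⟩
      #K + #O           ≤⟨ +-monoʳ-≤ #K unmarked≤marked ⟩
      #K + #K           ≡⟨ cong (#K +_) (sym (+-identityʳ #K)) ⟩
      2 * #K            ∎
      where
        open ≤-Reasoning

        #O #K : ℕ
        #O = count unmarkedCell U
        #K = count markedCell U

toPoint : ∀ {n} → Cell n → Point
toPoint (i , j) = toℕ i , toℕ j

toPoint-injective : ∀ {n} {c c′ : Cell n} → toPoint c ≡ toPoint c′ → c ≡ c′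
toPoint-injective {c = _ , _} {_ , _} e =
  cong₂ _,_ (toℕ-injective (cong proj₁ e)) (toℕ-injective (cong proj₂ e))

cells : ∀ n → List (Cell n)
cells n = cartesianProduct (allFin n) (allFin n)

points : ℕ → List Point
points n = map toPoint (cells n)

module _ {n : ℕ} where

  -- Opaque, so that `extend p y` stays rigid and unification can recover p and y.
  opaque
    extend : (Cell n → Bool) → Point → Bool
    extend p (a , b) with a <? n | b <? n
    ... | yes a<n | yes b<n = p (fromℕ< a<n , fromℕ< b<n)
    ... | _       | _       = false

    extend-toPoint : ∀ (p : Cell n → Bool) c → extend p (toPoint c) ≡ p c
    extend-toPoint p (i , j) with toℕ i <? n | toℕ j <? n
    ... | yes i<n | yes j<n = cong₂ (λ i j → p (i , j)) (fromℕ<-toℕ i i<n) (fromℕ<-toℕ j j<n)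
    ... | no i≮n  | _       = contradiction (toℕ<n i) i≮n
    ... | yes _   | no j≮n  = contradiction (toℕ<n j) j≮n

    extend-view : ∀ {p y} → T (extend p y) → ∃ λ c → toPoint c ≡ y × T (p c)
    extend-view {y = a , b} t with a <? n | b <? n
    ... | yes a<n | yes b<n =
          (fromℕ< a<n , fromℕ< b<n) , cong₂ _,_ (toℕ-fromℕ< a<n) (toℕ-fromℕ< b<n) , t

  extend-intro : ∀ {p c y} → toPoint c ≡ y → T (p c) → T (extend p y)
  extend-intro {p} {c} refl pc = subst T (sym (extend-toPoint p c)) pc

  extend-mono : ∀ {p q y} → (∀ {c} → toPoint c ≡ y → T (p c) → T (q c)) →
                T (extend p y) → T (extend q y)
  extend-mono p⇒q t with c , c↦y , pc ← extend-view t = extend-intro c↦y (p⇒q c↦y pc)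

  extend-bounded : ∀ {p a b} → T (extend p (a , b)) → a < n × b < n
  extend-bounded t with (i , j) , refl , _ ← extend-view t = toℕ<n i , toℕ<n j

  full-columnConvex : Board.ColumnConvex (extend (full n))
  full-columnConvex j {b = b} a≤b b≤d _ d∈ with (i , j′) , refl , _ ← extend-view d∈ =
    extend-intro {c = fromℕ< b<n , j′} (cong (_, toℕ j′) (toℕ-fromℕ< b<n)) _
    where
      b<n : b < n
      b<n = ≤-<-trans b≤d (toℕ<n i)

  ∈-cells : ∀ c → c ∈ cells n
  ∈-cells (i , j) = ∈-cartesianProduct⁺ (∈-allFin i) (∈-allFin j)

  points-unique : Unique (points n)
  points-unique = map⁺ toPoint-injective (cartesianProduct⁺ (allFin⁺ n) (allFin⁺ n))

  points-complete : ∀ {p y} → T (extend p y) → y ∈ points n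
  points-complete t with c , refl , _ ← extend-view t = ∈-map⁺ toPoint (∈-cells c)

  countCells≡count : ∀ p → countCells n p ≡ count p (cells n)
  countCells≡count p = sum-indicator-cartesianProduct p (allFin n) (allFin n)

  countCells≡count-points : ∀ p (q : Point → Bool) → (∀ c → q (toPoint c) ≡ p c) →
                            countCells n p ≡ count q (points n)
  countCells≡count-points p q q∘toPoint≗p = begin
    countCells n p                ≡⟨ countCells≡count p ⟩
    count p (cells n)             ≡⟨ count-cong (sym ∘ q∘toPoint≗p) (cells n) ⟩
    count (q ∘ toPoint) (cells n) ≡⟨ sym (count-map q toPoint (cells n)) ⟩
    count q (points n)            ∎
    where open ≡-Reasoning

UniqueAdjacent : ∀ {n} → (Fin n → Set) → Fin n → Set
UniqueAdjacent P t = ∀ t₁ t₂ → P t₁ → AdjIdx t t₁ → P t₂ → AdjIdx t t₂ → t₁ ≡ t₂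

module _ {n : ℕ} (P : Fin n → Set) (line : ℕ → Bool)
         (P⇔line : ∀ s → P s ⇔ T (line (toℕ s))) (line-bounded : ∀ {m} → T (line m) → m < n) where

  uniqueAdjacent⇔ : ∀ t →
    UniqueAdjacent P t ⇔ (¬ (T (before line (toℕ t)) × T (line (suc (toℕ t)))))
  uniqueAdjacent⇔ t = mk⇔ ⇒ ⇐
    where
      onLine : ∀ {m} → T (line m) → ∃ λ s → toℕ s ≡ m × P s
      onLine l = fromℕ< (line-bounded l) , toℕ-fromℕ< _ ,
                 from (P⇔line _) (subst (T ∘ line) (sym (toℕ-fromℕ< _)) l)

      left : ∀ {s} → toℕ t ≡ suc (toℕ s) → P s → T (before line (toℕ t))
      left {s} t≡ p = subst (T ∘ before line) (sym t≡) (to (P⇔line s) p)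

      right : ∀ {s} → toℕ s ≡ suc (toℕ t) → P s → T (line (suc (toℕ t)))
      right {s} s≡ p = subst (T ∘ line) s≡ (to (P⇔line s) p)

      ⇒ : UniqueAdjacent P t → ¬ (T (before line (toℕ t)) × T (line (suc (toℕ t))))
      ⇒ unique (b , a) =
        let m , t≡ , l = before-view b
            s₁ , s₁≡ , p₁ = onLine l
            s₂ , s₂≡ , p₂ = onLine a
            s₁≡s₂ = unique s₁ s₂ p₁ (inj₂ (trans t≡ (cong suc (sym s₁≡)))) p₂ (inj₁ s₂≡)
            m≡2+m : m ≡ suc (suc m)
            m≡2+m = trans (sym s₁≡) (trans (cong toℕ s₁≡s₂) (trans s₂≡ (cong suc t≡)))
        in <⇒≢ (m<n⇒m<1+n (n<1+n m)) m≡2+m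

      ⇐ : ¬ (T (before line (toℕ t)) × T (line (suc (toℕ t)))) → UniqueAdjacent P t
      ⇐ _ _ _ _ (inj₁ r₁) _  (inj₁ r₂) = toℕ-injective (trans r₁ (sym r₂))
      ⇐ _ _ _ _ (inj₂ l₁) _  (inj₂ l₂) = toℕ-injective (suc-injective (trans (sym l₁) l₂))
      ⇐ ¬both _ _ p₁ (inj₁ r₁) p₂ (inj₂ l₂) = ⊥-elim (¬both (left l₂ p₂ , right r₁ p₁))
      ⇐ ¬both _ _ p₁ (inj₂ l₁) p₂ (inj₁ r₂) = ⊥-elim (¬both (left l₁ p₁ , right r₂ p₂))

module _ {n : ℕ} {D : Diagram n} where

  remove-⊆ : ∀ {c x} → Present (remove D c) x → Present D x
  remove-⊆ {ci , cj} {xi , xj} p with ⌊ ci ≟ xi ⌋ ∧ ⌊ cj ≟ xj ⌋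
  remove-⊆ () | true
  ... | false = p

  remove-keeps : ∀ {c x} → Present D x → x ≢ c → Present (remove D c) x
  remove-keeps {ci , cj} {xi , xj} p x≢c with ci ≟ xi | cj ≟ xj
  ... | yes refl | yes refl = ⊥-elim (x≢c refl)
  ... | yes _    | no _     = p
  ... | no _     | _        = p

  remove-gone : ∀ c → ¬ Present (remove D c) c
  remove-gone (ci , cj) with ci ≟ ci | cj ≟ cj
  ... | yes _    | yes _    = λ ()
  ... | no ci≢ci | _        = ⊥-elim (ci≢ci refl)
  ... | yes _    | no cj≢cj = ⊥-elim (cj≢cj refl)

  remove-shrinks : ∀ {c} → Present D c → size (remove D c) < size D
  remove-shrinks {c} p =
    subst₂ _<_ (sym (countCells≡count (remove D c))) (sym (countCells≡count D))
      (count-mono-< (∈-cells c) (from T-≡ p) (remove-gone c ∘ to T-≡)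
                    (from T-≡ ∘ remove-⊆ {c} ∘ to T-≡))

  present⇔ : ∀ c → Present D c ⇔ T (extend D (toPoint c))
  present⇔ c = mk⇔ (λ p → subst T (sym (extend-toPoint D c)) (from T-≡ p))
                   (λ t → to T-≡ (subst T (extend-toPoint D c) t))

  extend-remove-⊆ : ∀ {c y} → T (extend (remove D c) y) → T (extend D y)
  extend-remove-⊆ {c} = extend-mono λ _ → from T-≡ ∘ remove-⊆ {c} ∘ to T-≡

  extend-remove-keeps : ∀ {c y} → T (extend D y) → y ≢ toPoint c → T (extend (remove D c) y)
  extend-remove-keeps t y≢c = extend-mono (λ c′↦y p → from T-≡ (remove-keeps (to T-≡ p)
    λ c′≡c → y≢c (trans (sym c′↦y) (cong toPoint c′≡c)))) t

  extend-remove-gone : ∀ c → ¬ T (extend (remove D c) (toPoint c))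
  extend-remove-gone c t = remove-gone c (to T-≡ (subst T (extend-toPoint (remove D c) c) t))

  open Board (extend D)

  corner⇔ : ∀ {c} → Present D c → Corner D c ⇔
    (¬ (T (hasLeft (toPoint c)) × T (hasRight (toPoint c))) ×
     ¬ (T (hasAbove (toPoint c)) × T (hasBelow (toPoint c))))
  corner⇔ {i , j} p = mk⇔ (λ (_ , row , column) → to inRow row , to inColumn column)
                          (λ (¬lr , ¬ab) → p , from inRow ¬lr , from inColumn ¬ab)
    where
      inRow : UniqueAdjacent (λ j₁ → Present D (i , j₁)) j ⇔
              (¬ (T (hasLeft (toℕ i , toℕ j)) × T (hasRight (toℕ i , toℕ j))))
      inRow = uniqueAdjacent⇔ (λ j₁ → Present D (i , j₁)) (λ m → extend D (toℕ i , m))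
                (λ j₁ → present⇔ (i , j₁)) (proj₂ ∘ extend-bounded {p = D} {toℕ i}) j

      inColumn : UniqueAdjacent (λ i₁ → Present D (i₁ , j)) i ⇔
                 (¬ (T (hasAbove (toℕ i , toℕ j)) × T (hasBelow (toℕ i , toℕ j))))
      inColumn = uniqueAdjacent⇔ (λ i₁ → Present D (i₁ , j)) (λ m → extend D (m , toℕ j))
                   (λ i₁ → present⇔ (i₁ , j)) (λ {m} → proj₁ ∘ extend-bounded {p = D} {m} {toℕ j}) i

truncated⇒columnConvex : ∀ {n} {D : Diagram n} → TruncatedSquare n D → Board.ColumnConvex (extend D)
truncated⇒columnConvex fullTS = full-columnConvex
truncated⇒columnConvex (removeTS c ts corner) =
  columnConvex-delete (truncated⇒columnConvex ts) (proj₂ (to (corner⇔ (proj₁ corner)) corner))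
    (extend (remove _ c)) (extend-remove-⊆ {c = c}) extend-remove-keeps (extend-remove-gone c)

chessColoring-remove : ∀ {n} {D : Diagram n} {col c} →
                       ChessColoring D col → ChessColoring (remove D c) col
chessColoring-remove {D = D} {c = c} chess a b a∈ b∈ =
  chess a b (remove-⊆ {D = D} {c} a∈) (remove-⊆ {D = D} {c} b∈)

≟C-refl : ∀ k → T (k ≟C k)
≟C-refl white = _
≟C-refl black = _

≟C-opposite : ∀ {a b} k → a ≢ b → ¬ T (a ≟C k) → T (b ≟C k)
≟C-opposite {white} {white} _     a≢b _ = ⊥-elim (a≢b refl)
≟C-opposite {black} {black} _     a≢b _ = ⊥-elim (a≢b refl)
≟C-opposite {white} {black} black _   _ = _
≟C-opposite {black} {white} white _   _ = _
≟C-opposite {white} {black} white _   ¬a = ⊥-elim (¬a _)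
≟C-opposite {black} {white} black _   ¬a = ⊥-elim (¬a _)

adjacent⇒neighbours : ∀ {n} {c c′ : Cell n} → Adjacent (toPoint c) (toPoint c′) → Neighbors c c′
adjacent⇒neighbours {c = _ , _} {_ , _} (inj₁ (i≡i′ , adj)) = inj₁ (toℕ-injective i≡i′ , adj)
adjacent⇒neighbours {c = _ , _} {_ , _} (inj₂ (j≡j′ , adj)) = inj₂ (toℕ-injective j≡j′ , adj)

module _ {n : ℕ} {D : Diagram n} {col : Coloring n} (k : Color) where

  open Board (extend D)
  open Balance (extend D) (extend (λ c → col c ≟C k))

  unmarked-view : ∀ {x} → T (unmarkedCell x) →
                  ∃ λ c → toPoint c ≡ x × Present D c × ¬ T (col c ≟C k)
  unmarked-view u with c , refl , Dc ← extend-view (proj₁ (to T-∧ u)) =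
    c , refl , to T-≡ Dc , T-not⇒¬T (subst (T ∘ not) (extend-toPoint _ c) (proj₂ (to T-∧ u)))

  chess⇒opposite : ChessColoring D col → ∀ {x y} →
    T (unmarkedCell x) → T (extend D y) → Adjacent x y → T (extend (λ c → col c ≟C k) y)
  chess⇒opposite chess u y∈ adj
    with c , refl , Dc , ¬k ← unmarked-view u | c′ , refl , Dc′ ← extend-view y∈ =
    extend-intro refl (≟C-opposite k (chess c c′ Dc (to T-≡ Dc′) (adjacent⇒neighbours adj)) ¬k)

  cornersK⇒notCorner : (∀ c → Corner D c → col c ≡ k) → ∀ {x} → T (unmarkedCell x) →
    ¬ T (hasLeft x) ⊎ ¬ T (hasRight x) → T (hasAbove x) × T (hasBelow x)
  cornersK⇒notCorner cornersK u ¬side with c , refl , Dc , ¬k ← unmarked-view u =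
    decidable-stable (T? (hasAbove (toPoint c)) ×-dec T? (hasBelow (toPoint c))) λ ¬vertical →
      let corner = from (corner⇔ Dc) ([ _∘ proj₁ , _∘ proj₂ ] ¬side , ¬vertical)
      in ¬k (subst (λ a → T (a ≟C k)) (sym (cornersK c corner)) (≟C-refl k))

  size≤2*sizeOf : TruncatedSquare n D → ChessColoring D col → (∀ c → Corner D c → col c ≡ k) →
                  size D ≤ 2 * sizeOf D col k
  size≤2*sizeOf ts chess cornersK = begin
    size D                          ≡⟨ countCells≡count-points D (extend D) (extend-toPoint D) ⟩
    count (extend D) (points n)     ≤⟨ board≤2*marked (points n) points-unique points-complete
                                         (truncated⇒columnConvex ts) (chess⇒opposite chess)
                                         (cornersK⇒notCorner cornersK) ⟩
    2 * count markedCell (points n) ≡⟨ cong (2 *_) (sym (countCells≡count-points _ _ marked-toPoint)) ⟩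
    2 * sizeOf D col k              ∎
    where
      open ≤-Reasoning

      marked-toPoint : ∀ c → markedCell (toPoint c) ≡ (D c ∧ (col c ≟C k))
      marked-toPoint c = cong₂ _∧_ (extend-toPoint D c) (extend-toPoint _ c)

balanced-acc : ∀ {n} {col : Coloring n} {D} → Acc (_<_ on size) D →
               TruncatedSquare n D → ChessColoring D col → Balanced col D
balanced-acc (acc smaller) ts chess =
  balanced (λ c corner → balanced-acc (smaller (remove-shrinks {c = c} (proj₁ corner)))
                                      (removeTS c ts corner) (chessColoring-remove {c = c} chess))
           (λ k cornersK → size≤2*sizeOf k ts chess cornersK)

mainTheorem11 : (n : ℕ) (D : Diagram n) (col : Coloring n)
  → TruncatedSquare n D → ChessColoring D col → Balanced col D
mainTheorem11 n D col = balanced-acc (On.wellFounded size <-wellFounded D)
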